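{- For every integer $n\ge 2$, $P_b(P_n)=\operatorname{diam}(P_n)=n-1$, and for every integer $n\ge 3$, $P_b(C_n)=\operatorname{diam}(C_n)=\left\lfloor\frac{n}{2}\right\rfloor$, where $P_n$ and $C_n$ are the path and cycle of order $n$.
   Context: For a graph $G=(V,E)$, a broadcast is a function $f:V\to\{0,\dots,\operatorname{diam}(G)\}$ with $f(v)\le e_G(v)$ (eccentricity) for all $v$. Let $V^+_f=\{v: f(v)>0\}$ and $H_f(u)=\{v\in V^+_f: d_G(u,v)\le f(v)\}$. The cost is $\sigma(f)=\sum_v f(v)$. $f$ is a packing broadcast if $|H_f(u)|\le1$ for every $u\in V$. $P_b(G)$ is the maximum cost of a packing broadcast on $G$. -}

module Defs where

open import Data.Nat using (ℕ; zero; suc; _≤_; _<_; _∸_)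
open import Data.Fin using (Fin; toℕ)
open import Data.Vec using (sum; tabulate)
open import Data.Product using (Σ; ∃; _×_)
open import Data.Sum using (_⊎_)
open import Relation.Nullary using (¬_)
open import Relation.Binary.PropositionalEquality using (_≡_)

record Graph (n : ℕ) : Set₁ where
  field
    Adj : Fin n → Fin n → Set
open Graph public

data Walk {n : ℕ} (G : Graph n) : Fin n → Fin n → ℕ → Set where
  nil  : ∀ {u} → Walk G u u 0
  cons : ∀ {u w v k} → Adj G u w → Walk G w v k → Walk G u v (suc k)

DistLe : ∀ {n} → Graph n → Fin n → Fin n → ℕ → Set
DistLe G u v k = Σ ℕ λ m → m ≤ k × Walk G u v m

DistGe : ∀ {n} → Graph n → Fin n → Fin n → ℕ → Set
DistGe G u v k = ∀ m → m < k → ¬ Walk G u v m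

DiamIs : ∀ {n} → Graph n → ℕ → Set
DiamIs G k = (∀ u v → DistLe G u v k) × (∃ λ u → ∃ λ v → DistGe G u v k)

-- f is a broadcast: f(v) ≤ e(v), i.e. some vertex w has d(v,w) ≥ f(v).
-- (The bound f(v) ≤ diam(G) follows from this.)
IsBroadcast : ∀ {n} → Graph n → (Fin n → ℕ) → Set
IsBroadcast G f = ∀ v → ∃ λ w → DistGe G v w (f v)

-- |H_f(u)| ≤ 1 for every u
IsPackingBroadcast : ∀ {n} → Graph n → (Fin n → ℕ) → Set
IsPackingBroadcast G f =
  IsBroadcast G f ×
  (∀ u v₁ v₂ → 0 < f v₁ → 0 < f v₂ →
     DistLe G u v₁ (f v₁) → DistLe G u v₂ (f v₂) → v₁ ≡ v₂)

cost : ∀ {n} → (Fin n → ℕ) → ℕ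
cost {n} f = sum (tabulate {n = n} f)

PbIs : ∀ {n} → Graph n → ℕ → Set
PbIs G k =
  (∃ λ f → IsPackingBroadcast G f × cost f ≡ k) ×
  (∀ f → IsPackingBroadcast G f → cost f ≤ k)

PathAdj : ∀ {n} → Fin n → Fin n → Set
PathAdj i j = suc (toℕ i) ≡ toℕ j ⊎ suc (toℕ j) ≡ toℕ i

PathG : (n : ℕ) → Graph n
PathG n = record { Adj = PathAdj }

CycleG : (n : ℕ) → Graph n
CycleG n = record { Adj = λ i j →
  PathAdj i j
  ⊎ (toℕ i ≡ 0 × suc (toℕ j) ≡ n)
  ⊎ (toℕ j ≡ 0 × suc (toℕ i) ≡ n) }

-- Lower bounds: one vertex broadcasting with strength diam(G) from an end of
-- the path, resp. from any vertex of the cycle, is a packing broadcast.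
-- Upper bounds by double counting: for a packing broadcast the balls of radius
-- f(v) around the broadcasting vertices v are pairwise disjoint, and since
-- f(v) ≤ e(v) such a ball contains a window of f(v) + 1 consecutive vertices of
-- P_n, resp. 2 f(v) vertices of C_n (where 2 f(v) ≤ n).  Summing over V⁺ gives
-- σ(f) + |V⁺| ≤ n on P_n, with |V⁺| ≥ 1 unless σ(f) = 0, and 2 σ(f) ≤ n on C_n.

module Submission where

open import Defs
open import Data.Nat
open import Data.Nat.Properties
open import Data.Nat.DivMod using (_/_; m≡m%n+[m/n]*n; m%n<n; m/n*n≤m; m*n/n≡m; /-monoˡ-≤; m/n<m)
open import Data.Fin using (Fin; zero; suc; toℕ; fromℕ; fromℕ<)
open import Data.Fin.Properties using (toℕ-injective; toℕ<n; toℕ-fromℕ; toℕ-fromℕ<)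
  renaming (suc-injective to Fin-suc-injective)
open import Data.Product using (∃; _×_; _,_)
open import Data.Sum using (_⊎_; inj₁; inj₂; [_,_]′) renaming (swap to ⊎-swap)
open import Function using (_∘_)
open import Relation.Binary.Definitions using (Symmetric)
open import Relation.Binary.PropositionalEquality
open import Relation.Nullary using (Dec; yes; no; ¬_; contradiction)
open import Relation.Nullary.Decidable using (_×-dec_)
open import Algebra.Properties.CommutativeMonoid.Sum +-0-commutativeMonoid
  using (sum-syntax; ∑-comm; ∑-distrib-+; sum-cong-≗; sum-replicate-zero)
open import Algebra.Properties.CommutativeSemigroup +-commutativeSemigroup
  using (x∙yz≈y∙xz)

open ≤-Reasoning

cost≡∑ : ∀ {n} (f : Fin n → ℕ) → cost f ≡ ∑[ i < n ] f i
cost≡∑ {zero}  f = refl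
cost≡∑ {suc n} f = cong (f zero +_) (cost≡∑ (f ∘ suc))

∑-mono-≤ : ∀ {n} {f g : Fin n → ℕ} → (∀ i → f i ≤ g i) → ∑[ i < n ] f i ≤ ∑[ i < n ] g i
∑-mono-≤ {zero}  f≤g = z≤n
∑-mono-≤ {suc n} f≤g = +-mono-≤ (f≤g zero) (∑-mono-≤ (f≤g ∘ suc))

≤-∑ : ∀ {n} (f : Fin n → ℕ) i → f i ≤ ∑[ j < n ] f j
≤-∑ f zero    = m≤m+n _ _
≤-∑ f (suc i) = ≤-trans (≤-∑ (f ∘ suc) i) (m≤n+m _ _)

∑-positive : ∀ {n} (f : Fin n → ℕ) → 0 < ∑[ i < n ] f i → ∃ λ i → 0 < f i
∑-positive {suc n} f 0<∑ with f zero in eq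
... | suc _ = zero , subst (0 <_) (sym eq) z<s
... | zero  = let (i , 0<fᵢ) = ∑-positive (f ∘ suc) 0<∑ in suc i , 0<fᵢ

∑-≤1 : ∀ {n} (f : Fin n → ℕ) → (∀ i → f i ≤ 1) → (∀ i j → 0 < f i → 0 < f j → i ≡ j) →
       ∑[ i < n ] f i ≤ 1
∑-≤1 {zero}  _ _ _ = z≤n
∑-≤1 {suc n} f f≤1 unique with f zero in eq
... | zero  = ∑-≤1 (f ∘ suc) (f≤1 ∘ suc) λ i j p q → Fin-suc-injective (unique (suc i) (suc j) p q)
... | suc _ = +-mono-≤ (subst (_≤ 1) eq (f≤1 zero))
                       (≤-trans (∑-mono-≤ rest≤0) (≤-reflexive (sum-replicate-zero n)))
  where
  rest≤0 : ∀ i → f (suc i) ≤ 0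
  rest≤0 i = ≮⇒≥ λ 0<fᵢ → contradiction (unique zero (suc i) (subst (0 <_) (sym eq) z<s) 0<fᵢ) λ ()

∑ℕ : ℕ → (ℕ → ℕ) → ℕ
∑ℕ n h = ∑[ i < n ] h (toℕ i)

∑ℕ-split : ∀ h a b → ∑ℕ (a + b) h ≡ ∑ℕ a h + ∑ℕ b (λ i → h (a + i))
∑ℕ-split h zero    b = refl
∑ℕ-split h (suc a) b = trans (cong (h 0 +_) (∑ℕ-split (h ∘ suc) a b)) (sym (+-assoc (h 0) _ _))

∑ℕ-cong : ∀ {g h} n → (∀ u → u < n → g u ≡ h u) → ∑ℕ n g ≡ ∑ℕ n h
∑ℕ-cong n g≡h = sum-cong-≗ λ i → g≡h (toℕ i) (toℕ<n i)

∑ℕ-mono-≤ : ∀ {g h} n → (∀ u → u < n → g u ≤ h u) → ∑ℕ n g ≤ ∑ℕ n h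
∑ℕ-mono-≤ n g≤h = ∑-mono-≤ λ i → g≤h (toℕ i) (toℕ<n i)

∑ℕ-ones : ∀ n → ∑ℕ n (λ _ → 1) ≡ n
∑ℕ-ones zero    = refl
∑ℕ-ones (suc n) = cong suc (∑ℕ-ones n)

∑ℕ-window : ∀ {h} n s k → s + k ≤ n → (∀ i → i < k → 1 ≤ h (s + i)) → k ≤ ∑ℕ n h
∑ℕ-window {h} n s k s+k≤n marked = begin
  k                                                      ≡⟨ ∑ℕ-ones k ⟨
  ∑ℕ k (λ _ → 1)                                         ≤⟨ ∑ℕ-mono-≤ k marked ⟩
  ∑ℕ k (λ i → h (s + i))                                 ≤⟨ m≤n+m _ _ ⟩
  ∑ℕ s h + ∑ℕ k (λ i → h (s + i))                        ≡⟨ ∑ℕ-split h s k ⟨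
  ∑ℕ (s + k) h                                           ≤⟨ m≤m+n _ _ ⟩
  ∑ℕ (s + k) h + ∑ℕ (n ∸ (s + k)) (λ i → h (s + k + i))  ≡⟨ ∑ℕ-split h (s + k) (n ∸ (s + k)) ⟨
  ∑ℕ (s + k + (n ∸ (s + k))) h                           ≡⟨ cong (λ x → ∑ℕ x h) (m+[n∸m]≡n s+k≤n) ⟩
  ∑ℕ n h                                                 ∎

𝟙 : ∀ {P : Set} → Dec P → ℕ
𝟙 (yes _) = 1
𝟙 (no _)  = 0

𝟙-≤1 : ∀ {P : Set} (d : Dec P) → 𝟙 d ≤ 1
𝟙-≤1 (yes _) = s≤s z≤n
𝟙-≤1 (no _)  = z≤n

𝟙-true : ∀ {P : Set} → P → (d : Dec P) → 1 ≤ 𝟙 d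
𝟙-true _ (yes _) = s≤s z≤n
𝟙-true p (no ¬p) = contradiction p ¬p

𝟙-positive : ∀ {P : Set} (d : Dec P) → 0 < 𝟙 d → P
𝟙-positive (yes p) _ = p

𝟙+𝟙-≤1 : ∀ {P Q : Set} (d : Dec P) (e : Dec Q) → (P → ¬ Q) → 𝟙 d + 𝟙 e ≤ 1
𝟙+𝟙-≤1 (yes p) (yes q) disjoint = contradiction q (disjoint p)
𝟙+𝟙-≤1 (yes _) (no _)  _        = s≤s z≤n
𝟙+𝟙-≤1 (no _)  e       _        = 𝟙-≤1 e

𝟙+𝟙-positive : ∀ {P Q : Set} (d : Dec P) (e : Dec Q) → 0 < 𝟙 d + 𝟙 e → P ⊎ Q
𝟙+𝟙-positive (yes p) e       _ = inj₁ p
𝟙+𝟙-positive (no _)  (yes q) _ = inj₂ q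

module _ {n} {G : Graph n} where

  walk-snoc : ∀ {u v w k} → Walk G u v k → Adj G v w → Walk G u w (suc k)
  walk-snoc nil        e = cons e nil
  walk-snoc (cons x p) e = cons x (walk-snoc p e)

  _++ʷ_ : ∀ {u v w a b} → Walk G u v a → Walk G v w b → Walk G u w (a + b)
  nil      ++ʷ q = q
  cons x p ++ʷ q = cons x (p ++ʷ q)

  walk-reverse : Symmetric (Adj G) → ∀ {u v k} → Walk G u v k → Walk G v u k
  walk-reverse adj-sym nil        = nil
  walk-reverse adj-sym (cons x p) = walk-snoc (walk-reverse adj-sym p) (adj-sym x)

  DistGe⇒≤length : ∀ {u v k m} → DistGe G u v k → Walk G u v m → k ≤ m
  DistGe⇒≤length far p = ≮⇒≥ λ m<k → far _ m<k p

  Lipschitz : (Fin n → ℕ) → Set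
  Lipschitz φ = ∀ {a b} → Adj G a b → φ b ≤ suc (φ a)

  Lipschitz⇒walk-bound : ∀ {φ} → Lipschitz φ → ∀ {u v k} → Walk G u v k → φ v ≤ φ u + k
  Lipschitz⇒walk-bound {φ} step {u} nil = m≤m+n (φ u) 0
  Lipschitz⇒walk-bound {φ} step {u} (cons {k = k} x p) = begin
    φ _           ≤⟨ Lipschitz⇒walk-bound step p ⟩
    φ _ + k       ≤⟨ +-monoˡ-≤ k (step x) ⟩
    suc (φ u) + k ≡⟨ +-suc (φ u) k ⟨
    φ u + suc k   ∎

  Lipschitz⇒DistGe : ∀ {φ} → Lipschitz φ → ∀ {u v k} → φ u ≡ 0 → k ≤ φ v → DistGe G u v k
  Lipschitz⇒DistGe {φ} step {v = v} φu≡0 k≤φv m m<k p =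
    <⇒≱ m<k (≤-trans k≤φv (subst (λ x → φ v ≤ x + m) φu≡0 (Lipschitz⇒walk-bound step p)))

walk-map : ∀ {n} {G H : Graph n} → (∀ {a b} → Adj G a b → Adj H a b) →
           ∀ {u v k} → Walk G u v k → Walk H u v k
walk-map _   nil        = nil
walk-map G⊆H (cons x p) = cons (G⊆H x) (walk-map G⊆H p)

-- Double counting for packing broadcasts

-- A mark I v u > 0 certifies d(u, v) ≤ f(v) for a broadcasting vertex v; rows
-- are indexed by positions in ℕ so that they can be counted window by window.
BallMarks : ∀ {n} → Graph n → (Fin n → ℕ) → (Fin n → ℕ → ℕ) → Set
BallMarks {n} G f I =
  (∀ v u → I v u ≤ 1) ×
  (∀ v (u : Fin n) → 0 < I v (toℕ u) → 0 < f v × DistLe G u v (f v))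

packing⇒∑rows≤n : ∀ {n} {G : Graph n} {f I} {g : Fin n → ℕ} →
  IsPackingBroadcast G f → BallMarks G f I → (∀ v → g v ≤ ∑ℕ n (I v)) →
  ∑[ v < n ] g v ≤ n
packing⇒∑rows≤n {n} {G} {f} {I} {g} (_ , disjoint) (I≤1 , I⇒ball) g≤row = begin
  ∑[ v < n ] g v                       ≤⟨ ∑-mono-≤ g≤row ⟩
  ∑[ v < n ] ∑[ u < n ] I v (toℕ u)    ≡⟨ ∑-comm {n} {n} (λ v u → I v (toℕ u)) ⟩
  ∑[ u < n ] ∑[ v < n ] I v (toℕ u)    ≤⟨ ∑-mono-≤ column≤1 ⟩
  ∑ℕ n (λ _ → 1)                       ≡⟨ ∑ℕ-ones n ⟩
  n                                    ∎
  where
  column≤1 : ∀ u → ∑[ v < n ] I v (toℕ u) ≤ 1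
  column≤1 u = ∑-≤1 _ (λ v → I≤1 v (toℕ u)) λ v w p q →
    let (0<fv , v-near) = I⇒ball v u p
        (0<fw , w-near) = I⇒ball w u q
    in disjoint u v w 0<fv 0<fw v-near w-near

single : ∀ {m} → ℕ → Fin (suc m) → ℕ
single c zero    = c
single c (suc _) = 0

cost-single : ∀ m c → cost (single {m} c) ≡ c
cost-single m c =
  trans (cong (c +_) (trans (cost≡∑ {m} (λ _ → 0)) (sum-replicate-zero m))) (+-identityʳ c)

PbIs×DiamIs-intro : ∀ {m} (G : Graph (suc m)) k w →
  (∀ u v → DistLe G u v k) → DistGe G zero w k →
  (∀ f → IsPackingBroadcast G f → cost f ≤ k) →
  PbIs G k × DiamIs G k
PbIs×DiamIs-intro {m} G k w near far cost≤ =
  ((single k , (eccentric , disjoint) , cost-single m k) , cost≤) , near , zero , w , far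
  where
  eccentric : IsBroadcast G (single k)
  eccentric zero    = w , far
  eccentric (suc _) = zero , λ _ ()
  disjoint : ∀ u v₁ v₂ → 0 < single k v₁ → 0 < single k v₂ →
             DistLe G u v₁ (single k v₁) → DistLe G u v₂ (single k v₂) → v₁ ≡ v₂
  disjoint _ zero zero _ _ _ _ = refl

≤∸1-if-positive : ∀ x {n} → (0 < x → x + 1 ≤ n) → x ≤ n ∸ 1
≤∸1-if-positive zero    _ = z≤n
≤∸1-if-positive (suc x) h = m+n≤o⇒m≤o∸n (suc x) (h z<s)

∣m-n∣≤o : ∀ {m n o} → m ≤ n + o → n ≤ m + o → ∣ m - n ∣ ≤ o
∣m-n∣≤o {m} {n} m≤n+o n≤m+o with ∣m-n∣≡[m∸n]∨[n∸m] m n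
... | inj₁ eq = subst (_≤ _) (sym eq) (m≤n+o⇒m∸n≤o m n m≤n+o)
... | inj₂ eq = subst (_≤ _) (sym eq) (m≤n+o⇒m∸n≤o n m n≤m+o)

radius-window : ∀ {a b r n} → a < n → b < n → r ≤ ∣ a - b ∣ →
                ∃ λ s → s + r < n × s ≤ a × a ≤ s + r
radius-window {a} {b} {r} a<n b<n r≤∣a-b∣ with ≤-total a b
... | inj₁ a≤b = a , ≤-<-trans (+-monoʳ-≤ a r≤b∸a) (subst (_< _) (sym (m+[n∸m]≡n a≤b)) b<n) ,
                 ≤-refl , m≤m+n a r
  where
  r≤b∸a : r ≤ b ∸ a
  r≤b∸a = subst (r ≤_) (m≤n⇒∣m-n∣≡n∸m a≤b) r≤∣a-b∣
... | inj₂ b≤a = a ∸ r , subst (_< _) (sym a∸r+r≡a) a<n , m∸n≤m a r , ≤-reflexive (sym a∸r+r≡a)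
  where
  a∸r+r≡a : a ∸ r + r ≡ a
  a∸r+r≡a = m∸n+n≡m (≤-trans (subst (r ≤_) (m≤n⇒∣n-m∣≡n∸m b≤a) r≤∣a-b∣) (m∸n≤m a b))

m*2≡m+m : ∀ m → m * 2 ≡ m + m
m*2≡m+m m = trans (*-comm m 2) (cong (m +_) (+-identityʳ m))

m+m≤n⇒m≤n/2 : ∀ {m n} → m + m ≤ n → m ≤ n / 2
m+m≤n⇒m≤n/2 {m} {n} m+m≤n = begin
  m           ≡⟨ m*n/n≡m m 2 ⟨
  m * 2 / 2   ≤⟨ /-monoˡ-≤ 2 (≤-trans (≤-reflexive (m*2≡m+m m)) m+m≤n) ⟩
  n / 2       ∎

n/2+n/2≤n : ∀ n → n / 2 + n / 2 ≤ n
n/2+n/2≤n n = ≤-trans (≤-reflexive (sym (m*2≡m+m (n / 2)))) (m/n*n≤m n 2)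

n≤1+n/2+n/2 : ∀ n → n ≤ suc (n / 2 + n / 2)
n≤1+n/2+n/2 n = begin
  n                       ≡⟨ m≡m%n+[m/n]*n n 2 ⟩
  n % 2 + n / 2 * 2       ≤⟨ +-mono-≤ (s≤s⁻¹ (m%n<n n 2)) (≤-reflexive (m*2≡m+m (n / 2))) ⟩
  suc (n / 2 + n / 2)     ∎

m∸n≤1+m∸1+n : ∀ m n → m ∸ n ≤ suc (m ∸ suc n)
m∸n≤1+m∸1+n zero    zero    = z≤n
m∸n≤1+m∸1+n zero    (suc n) = z≤n
m∸n≤1+m∸1+n (suc m) zero    = ≤-refl
m∸n≤1+m∸1+n (suc m) (suc n) = m∸n≤1+m∸1+n m n

-- Paths

path-sym : ∀ {n} → Symmetric (PathAdj {n})
path-sym = ⊎-swap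

path-toℕ-Lipschitz : ∀ {n} → Lipschitz {G = PathG n} toℕ
path-toℕ-Lipschitz (inj₁ 1+a≡b) = ≤-reflexive (sym 1+a≡b)
path-toℕ-Lipschitz (inj₂ 1+b≡a) = ≤-trans (n≤1+n _) (≤-trans (≤-reflexive 1+b≡a) (n≤1+n _))

path-walk-up : ∀ {n} k (u v : Fin n) → toℕ v ≡ toℕ u + k → Walk (PathG n) u v k
path-walk-up zero u v v≡u+0 =
  subst (λ x → Walk _ u x 0) (sym (toℕ-injective (trans v≡u+0 (+-identityʳ _)))) nil
path-walk-up {n} (suc k) u v v≡u+1+k =
  cons (inj₁ (sym (toℕ-fromℕ< u+1<n))) (path-walk-up k _ v v≡u′+k)
  where
  u+1<n : suc (toℕ u) < n
  u+1<n = ≤-<-trans (s≤s (m≤m+n (toℕ u) k)) (subst (_< n) (trans v≡u+1+k (+-suc _ k)) (toℕ<n v))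
  v≡u′+k : toℕ v ≡ toℕ (fromℕ< u+1<n) + k
  v≡u′+k = trans v≡u+1+k (trans (+-suc _ k) (cong (_+ k) (sym (toℕ-fromℕ< u+1<n))))

path-walk-≤ : ∀ {n} {u v : Fin n} → toℕ u ≤ toℕ v → Walk (PathG n) u v (toℕ v ∸ toℕ u)
path-walk-≤ u≤v = path-walk-up _ _ _ (sym (m+[n∸m]≡n u≤v))

path-walk : ∀ {n} (u v : Fin n) → Walk (PathG n) u v ∣ toℕ u - toℕ v ∣
path-walk u v with ≤-total (toℕ u) (toℕ v)
... | inj₁ u≤v = subst (Walk _ u v) (sym (m≤n⇒∣m-n∣≡n∸m u≤v)) (path-walk-≤ u≤v)
... | inj₂ v≤u =
  subst (Walk _ u v) (sym (m≤n⇒∣n-m∣≡n∸m v≤u)) (walk-reverse path-sym (path-walk-≤ v≤u))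

path-DistLe : ∀ {m} (u v : Fin (suc m)) → DistLe (PathG (suc m)) u v m
path-DistLe u v = ∣ toℕ u - toℕ v ∣ ,
  ≤-trans (∣m-n∣≤m⊔n (toℕ u) (toℕ v)) (⊔-lub (s≤s⁻¹ (toℕ<n u)) (s≤s⁻¹ (toℕ<n v))) ,
  path-walk u v

path-far : ∀ m → DistGe (PathG (suc m)) zero (fromℕ m) m
path-far m = Lipschitz⇒DistGe path-toℕ-Lipschitz refl (≤-reflexive (sym (toℕ-fromℕ m)))

path-window : ∀ {n f} → IsBroadcast (PathG n) f →
              ∀ v → ∃ λ s → s + f v < n × s ≤ toℕ v × toℕ v ≤ s + f v
path-window ecc v =
  let (w , far) = ecc v
  in radius-window (toℕ<n v) (toℕ<n w) (DistGe⇒≤length far (path-walk v w))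

path-marks : ∀ {n} → (Fin n → ℕ) → Fin n → ℕ → ℕ
path-marks f v u = 𝟙 (0 <? f v ×-dec (u ≤? toℕ v + f v ×-dec toℕ v ≤? u + f v))

path-ballMarks : ∀ {n f} → BallMarks (PathG n) f (path-marks f)
path-ballMarks {f = f} = (λ v u → 𝟙-≤1 _) , in-ball
  where
  in-ball : ∀ v u → 0 < path-marks f v (toℕ u) → 0 < f v × DistLe _ u v (f v)
  in-ball v u marked with 𝟙-positive _ marked
  ... | 0<fv , u≤v+r , v≤u+r = 0<fv , ∣ toℕ u - toℕ v ∣ , ∣m-n∣≤o u≤v+r v≤u+r , path-walk u v

path-row : ∀ {n f} → IsBroadcast (PathG n) f → ∀ v → f v + 𝟙 (0 <? f v) ≤ ∑ℕ n (path-marks f v)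
path-row {n} {f} ecc v = row (0 <? f v)
  where
  row : (d : Dec (0 < f v)) → f v + 𝟙 d ≤ ∑ℕ n (path-marks f v)
  row (no 0≮fv) = ≤-trans (≤-reflexive (trans (+-identityʳ (f v)) (n≤0⇒n≡0 (≮⇒≥ 0≮fv)))) z≤n
  row (yes 0<fv) with path-window ecc v
  ... | s , s+r<n , s≤v , v≤s+r = subst (_≤ ∑ℕ n (path-marks f v)) (+-comm 1 (f v))
    (∑ℕ-window {path-marks f v} n s (suc (f v)) (subst (_≤ n) (sym (+-suc s (f v))) s+r<n) marked)
    where
    marked : ∀ i → i < suc (f v) → 1 ≤ path-marks f v (s + i)
    marked i i≤r = 𝟙-true (0<fv , +-mono-≤ s≤v (s≤s⁻¹ i≤r) ,
                                 ≤-trans v≤s+r (+-monoˡ-≤ (f v) (m≤m+n s i))) _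

path-cost≤ : ∀ {n} f → IsPackingBroadcast (PathG n) f → cost f ≤ n ∸ 1
path-cost≤ {n} f pb@(ecc , _) = ≤∸1-if-positive (cost f) λ 0<cost → begin
  cost f + 1                                      ≤⟨ +-monoʳ-≤ (cost f) (some-broadcaster 0<cost) ⟩
  cost f + ∑[ v < n ] 𝟙 (0 <? f v)                ≡⟨ cong (_+ ∑[ v < n ] 𝟙 (0 <? f v)) (cost≡∑ f) ⟩
  ∑[ v < n ] f v + ∑[ v < n ] 𝟙 (0 <? f v)        ≡⟨ ∑-distrib-+ f _ ⟨
  ∑[ v < n ] (f v + 𝟙 (0 <? f v))                 ≤⟨ packing⇒∑rows≤n pb path-ballMarks (path-row ecc) ⟩
  n                                               ∎
  where
  some-broadcaster : 0 < cost f → 1 ≤ ∑[ v < n ] 𝟙 (0 <? f v)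
  some-broadcaster 0<cost =
    let (v , 0<fv) = ∑-positive f (subst (0 <_) (cost≡∑ f) 0<cost)
    in ≤-trans (𝟙-true 0<fv (0 <? f v)) (≤-∑ _ v)

-- Cycles

cycle-sym : ∀ {n} → Symmetric (Adj (CycleG n))
cycle-sym (inj₁ p)        = inj₁ (⊎-swap p)
cycle-sym (inj₂ (inj₁ p)) = inj₂ (inj₂ p)
cycle-sym (inj₂ (inj₂ p)) = inj₂ (inj₁ p)

module Cycle (m : ℕ) where

  n : ℕ
  n = suc m

  -- (b − a) mod n: the length of the walk a, a + 1, …, b around the cycle
  clockwise : ℕ → ℕ → ℕ
  clockwise a b with a ≤? b
  ... | yes _ = b ∸ a
  ... | no _  = n ∸ a + b

  clockwise-≤ : ∀ {a b} → a ≤ b → clockwise a b ≡ b ∸ a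
  clockwise-≤ {a} {b} a≤b with a ≤? b
  ... | yes _  = refl
  ... | no a≰b = contradiction a≤b a≰b

  clockwise-> : ∀ {a b} → b < a → clockwise a b ≡ n ∸ a + b
  clockwise-> {a} {b} b<a with a ≤? b
  ... | yes a≤b = contradiction a≤b (<⇒≱ b<a)
  ... | no _    = refl

  clockwise≤n∸a+b : ∀ a b → clockwise a b ≤ n ∸ a + b
  clockwise≤n∸a+b a b with a ≤? b
  ... | yes _ = ≤-trans (m∸n≤m b a) (m≤n+m b (n ∸ a))
  ... | no _  = ≤-refl

  clockwise-+-clockwise≤n : ∀ {a b} → a ≤ n → b ≤ n → clockwise a b + clockwise b a ≤ n
  clockwise-+-clockwise≤n {a} {b} a≤n b≤n =
    [ (λ a≤b → ordered a≤b b≤n)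
    , (λ b≤a → subst (_≤ n) (+-comm (clockwise b a) (clockwise a b)) (ordered b≤a a≤n))
    ]′ (≤-total a b)
    where
    ordered : ∀ {a b} → a ≤ b → b ≤ n → clockwise a b + clockwise b a ≤ n
    ordered {a} {b} a≤b b≤n = begin
      clockwise a b + clockwise b a   ≤⟨ +-mono-≤ (≤-reflexive (clockwise-≤ a≤b)) (clockwise≤n∸a+b b a) ⟩
      b ∸ a + (n ∸ b + a)             ≡⟨ x∙yz≈y∙xz (b ∸ a) (n ∸ b) a ⟩
      n ∸ b + (b ∸ a + a)             ≡⟨ cong (n ∸ b +_) (m∸n+n≡m a≤b) ⟩
      n ∸ b + b                       ≡⟨ m∸n+n≡m b≤n ⟩
      n                               ∎

  clockwise-walk : ∀ (v u : Fin n) → Walk (CycleG n) v u (clockwise (toℕ v) (toℕ u))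
  clockwise-walk v u with toℕ v ≤? toℕ u
  ... | yes v≤u = walk-map inj₁ (path-walk-≤ v≤u)
  ... | no _    = subst (Walk _ v u) length-eq (to-last ++ʷ cons last→zero from-zero)
    where
    v≤m : toℕ v ≤ toℕ (fromℕ m)
    v≤m = subst (toℕ v ≤_) (sym (toℕ-fromℕ m)) (s≤s⁻¹ (toℕ<n v))
    to-last : Walk (CycleG n) v (fromℕ m) (toℕ (fromℕ m) ∸ toℕ v)
    to-last = walk-map inj₁ (path-walk-≤ v≤m)
    last→zero : Adj (CycleG n) (fromℕ m) zero
    last→zero = inj₂ (inj₂ (refl , cong suc (toℕ-fromℕ m)))
    from-zero : Walk (CycleG n) zero u (toℕ u)
    from-zero = walk-map inj₁ (path-walk-≤ z≤n)
    length-eq : toℕ (fromℕ m) ∸ toℕ v + suc (toℕ u) ≡ n ∸ toℕ v + toℕ u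
    length-eq = begin-equality
      toℕ (fromℕ m) ∸ toℕ v + suc (toℕ u)   ≡⟨ cong (λ x → x ∸ toℕ v + suc (toℕ u)) (toℕ-fromℕ m) ⟩
      m ∸ toℕ v + suc (toℕ u)               ≡⟨ +-suc (m ∸ toℕ v) (toℕ u) ⟩
      suc (m ∸ toℕ v) + toℕ u               ≡⟨ cong (_+ toℕ u) (+-∸-assoc 1 (s≤s⁻¹ (toℕ<n v))) ⟨
      n ∸ toℕ v + toℕ u                     ∎

  cycle-radius : ∀ {f} → IsBroadcast (CycleG n) f → ∀ v → f v + f v ≤ n
  cycle-radius {f} ecc v =
    let (w , far) = ecc v
    in ≤-trans (+-mono-≤ (DistGe⇒≤length far (clockwise-walk v w))
                         (DistGe⇒≤length far (walk-reverse cycle-sym (clockwise-walk w v))))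
               (clockwise-+-clockwise≤n (<⇒≤ (toℕ<n v)) (<⇒≤ (toℕ<n w)))

  ∑ℕ-rotate : ∀ g {a} → a ≤ n → ∑ℕ n (g ∘ clockwise a) ≡ ∑ℕ n g
  ∑ℕ-rotate g {a} a≤n = begin-equality
    ∑ℕ n (g ∘ clockwise a)
      ≡⟨ cong (λ x → ∑ℕ x (g ∘ clockwise a)) (m+[n∸m]≡n a≤n) ⟨
    ∑ℕ (a + k) (g ∘ clockwise a)
      ≡⟨ ∑ℕ-split (g ∘ clockwise a) a k ⟩
    ∑ℕ a (g ∘ clockwise a) + ∑ℕ k (λ i → g (clockwise a (a + i)))
      ≡⟨ cong₂ _+_ (∑ℕ-cong a wrapped) (∑ℕ-cong k unwrapped) ⟩
    ∑ℕ a (λ i → g (k + i)) + ∑ℕ k g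
      ≡⟨ +-comm _ (∑ℕ k g) ⟩
    ∑ℕ k g + ∑ℕ a (λ i → g (k + i))
      ≡⟨ ∑ℕ-split g k a ⟨
    ∑ℕ (k + a) g
      ≡⟨ cong (λ x → ∑ℕ x g) (m∸n+n≡m a≤n) ⟩
    ∑ℕ n g
      ∎
    where
    k = n ∸ a
    wrapped : ∀ u → u < a → g (clockwise a u) ≡ g (k + u)
    wrapped u u<a = cong g (clockwise-> u<a)
    unwrapped : ∀ i → i < k → g (clockwise a (a + i)) ≡ g i
    unwrapped i _ = cong g (trans (clockwise-≤ (m≤m+n a i)) (m+n∸m≡n a i))

  -- Marks the clockwise offsets 0, …, r and n − r + 1, …, n − 1 from a centre:
  -- 2r vertices within distance r, pairwise distinct as long as 2r ≤ n.
  arc-marks : ℕ → ℕ → ℕ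
  arc-marks r j = 𝟙 (0 <? r ×-dec j ≤? r) + 𝟙 (n <? j + r)

  arc-marks-count : ∀ r → r + r ≤ n → r + r ≤ ∑ℕ n (arc-marks r)
  arc-marks-count zero    _ = z≤n
  arc-marks-count (suc g) r+r≤n = begin
    suc g + suc g              ≡⟨ +-suc (suc g) g ⟩
    suc (suc g) + g            ≤⟨ +-mono-≤ near-count wrapped-count ⟩
    ∑ℕ n near + ∑ℕ n wrapped   ≡⟨ ∑-distrib-+ {n} (near ∘ toℕ) (wrapped ∘ toℕ) ⟨
    ∑ℕ n (arc-marks (suc g))   ∎
    where
    near wrapped : ℕ → ℕ
    near j    = 𝟙 (0 <? suc g ×-dec j ≤? suc g)
    wrapped j = 𝟙 (n <? j + suc g)

    near-count : suc (suc g) ≤ ∑ℕ n near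
    near-count = ∑ℕ-window {near} n 0 (suc (suc g)) (≤-trans (s≤s (m≤n+m (suc g) g)) r+r≤n)
      λ i i<r+1 → 𝟙-true (z<s , s≤s⁻¹ i<r+1) _

    wrapped-count : g ≤ ∑ℕ n wrapped
    wrapped-count = ∑ℕ-window {wrapped} n (n ∸ g) g (≤-reflexive (m∸n+n≡m g≤n))
      λ i _ → 𝟙-true (n<n∸g+i+r i) _
      where
      g≤n : g ≤ n
      g≤n = ≤-trans (≤-trans (n≤1+n g) (m≤m+n (suc g) (suc g))) r+r≤n
      n<n∸g+i+r : ∀ i → n < n ∸ g + i + suc g
      n<n∸g+i+r i = begin-strict
        n                 ≤⟨ m≤n+m∸n n g ⟩
        g + (n ∸ g)       ≡⟨ +-comm g (n ∸ g) ⟩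
        n ∸ g + g         <⟨ +-monoʳ-< (n ∸ g) (n<1+n g) ⟩
        n ∸ g + suc g     ≤⟨ +-monoˡ-≤ (suc g) (m≤m+n (n ∸ g) i) ⟩
        n ∸ g + i + suc g ∎

  cycle-marks : (Fin n → ℕ) → Fin n → ℕ → ℕ
  cycle-marks f v u = arc-marks (f v) (clockwise (toℕ v) u)

  cycle-ballMarks : ∀ {f} → IsBroadcast (CycleG n) f → BallMarks (CycleG n) f (cycle-marks f)
  cycle-ballMarks {f} ecc = ≤1 , in-ball
    where
    ≤1 : ∀ v u → cycle-marks f v u ≤ 1
    ≤1 v u = 𝟙+𝟙-≤1 (0 <? f v ×-dec clockwise (toℕ v) u ≤? f v) (n <? clockwise (toℕ v) u + f v)
      λ (_ , j≤r) n<j+r → <⇒≱ n<j+r (≤-trans (+-monoˡ-≤ (f v) j≤r) (cycle-radius ecc v))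
    in-ball : ∀ v u → 0 < cycle-marks f v (toℕ u) → 0 < f v × DistLe (CycleG n) u v (f v)
    in-ball v u marked with 𝟙+𝟙-positive (0 <? f v ×-dec clockwise (toℕ v) (toℕ u) ≤? f v)
                                         (n <? clockwise (toℕ v) (toℕ u) + f v) marked
    ... | inj₁ (0<fv , j≤r) = 0<fv , _ , j≤r , walk-reverse cycle-sym (clockwise-walk v u)
    ... | inj₂ n<j+r        = ≤-<-trans z≤n back<r , _ , <⇒≤ back<r , clockwise-walk u v
      where
      back<r : clockwise (toℕ u) (toℕ v) < f v
      back<r = +-cancelˡ-< (clockwise (toℕ v) (toℕ u)) _ _
                 (≤-<-trans (clockwise-+-clockwise≤n (<⇒≤ (toℕ<n v)) (<⇒≤ (toℕ<n u))) n<j+r)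

  cycle-row : ∀ {f} → IsBroadcast (CycleG n) f → ∀ v → f v + f v ≤ ∑ℕ n (cycle-marks f v)
  cycle-row {f} ecc v = begin
    f v + f v                                 ≤⟨ arc-marks-count (f v) (cycle-radius ecc v) ⟩
    ∑ℕ n (arc-marks (f v))                    ≡⟨ ∑ℕ-rotate (arc-marks (f v)) (<⇒≤ (toℕ<n v)) ⟨
    ∑ℕ n (cycle-marks f v)                    ∎

  cycle-cost≤ : ∀ f → IsPackingBroadcast (CycleG n) f → cost f ≤ n / 2
  cycle-cost≤ f pb@(ecc , _) = m+m≤n⇒m≤n/2 (begin
    cost f + cost f                 ≡⟨ cong₂ _+_ (cost≡∑ f) (cost≡∑ f) ⟩
    ∑[ v < n ] f v + ∑[ v < n ] f v ≡⟨ ∑-distrib-+ f f ⟨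
    ∑[ v < n ] (f v + f v)          ≤⟨ packing⇒∑rows≤n pb (cycle-ballMarks ecc) (cycle-row ecc) ⟩
    n                               ∎)

  cyclic-norm : Fin n → ℕ
  cyclic-norm x = toℕ x ⊓ (n ∸ toℕ x)

  cyclic-norm-Lipschitz : Lipschitz {G = CycleG n} cyclic-norm
  cyclic-norm-Lipschitz (inj₁ (inj₁ 1+a≡b)) =
    ⊓-mono-≤ (≤-reflexive (sym 1+a≡b))
             (≤-trans (∸-monoʳ-≤ n (≤-trans (n≤1+n _) (≤-reflexive 1+a≡b))) (n≤1+n _))
  cyclic-norm-Lipschitz {b = b} (inj₁ (inj₂ 1+b≡a)) =
    ⊓-mono-≤ (≤-trans (n≤1+n _) (≤-trans (≤-reflexive 1+b≡a) (n≤1+n _)))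
             (subst (λ x → n ∸ toℕ b ≤ suc (n ∸ x)) 1+b≡a (m∸n≤1+m∸1+n n (toℕ b)))
  cyclic-norm-Lipschitz {a} {b} (inj₂ (inj₁ (_ , 1+b≡n))) = begin
    cyclic-norm b          ≤⟨ m⊓n≤n _ _ ⟩
    n ∸ toℕ b              ≡⟨ cong (_∸ toℕ b) 1+b≡n ⟨
    1 + toℕ b ∸ toℕ b      ≡⟨ m+n∸n≡m 1 (toℕ b) ⟩
    1                      ≤⟨ s≤s z≤n ⟩
    suc (cyclic-norm a)    ∎
  cyclic-norm-Lipschitz (inj₂ (inj₂ (b≡0 , _))) =
    ≤-trans (m⊓n≤m _ _) (≤-trans (≤-reflexive b≡0) z≤n)

  diam : ℕ
  diam = n / 2

  diam<n : diam < n
  diam<n = m/n<m n 2 (s≤s (s≤s z≤n))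

  antipode : Fin n
  antipode = fromℕ< diam<n

  cycle-far : DistGe (CycleG n) zero antipode diam
  cycle-far = Lipschitz⇒DistGe cyclic-norm-Lipschitz refl (begin
    diam                   ≡⟨ m≤n⇒m⊓n≡m (m+n≤o⇒m≤o∸n diam (n/2+n/2≤n n)) ⟨
    diam ⊓ (n ∸ diam)      ≡⟨ cong (λ x → x ⊓ (n ∸ x)) (toℕ-fromℕ< diam<n) ⟨
    cyclic-norm antipode   ∎)

  cycle-DistLe : ∀ u v → DistLe (CycleG n) u v diam
  cycle-DistLe u v with clockwise (toℕ u) (toℕ v) ≤? diam | clockwise (toℕ v) (toℕ u) ≤? diam
  ... | yes ≤diam | _         = _ , ≤diam , clockwise-walk u v
  ... | no _      | yes ≤diam = _ , ≤diam , walk-reverse cycle-sym (clockwise-walk v u)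
  ... | no >diam  | no >diam′ =
    contradiction (clockwise-+-clockwise≤n (<⇒≤ (toℕ<n u)) (<⇒≤ (toℕ<n v))) (<⇒≱ (begin-strict
      n                                                      ≤⟨ n≤1+n/2+n/2 n ⟩
      suc (diam + diam)                                      <⟨ s≤s (+-monoʳ-< diam (n<1+n diam)) ⟩
      suc diam + suc diam                                    ≤⟨ +-mono-≤ (≰⇒> >diam) (≰⇒> >diam′) ⟩
      clockwise (toℕ u) (toℕ v) + clockwise (toℕ v) (toℕ u)  ∎))

theorem3p14 :
    ((n : ℕ) → 2 ≤ n → PbIs (PathG n) (n ∸ 1) × DiamIs (PathG n) (n ∸ 1))
    × ((n : ℕ) → 3 ≤ n → PbIs (CycleG n) (n / 2) × DiamIs (CycleG n) (n / 2))
theorem3p14 = path , cycle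
  where
  -- Both arguments work for every n ≥ 1; the bounds on n only rule out n = 0.
  path : (n : ℕ) → 2 ≤ n → PbIs (PathG n) (n ∸ 1) × DiamIs (PathG n) (n ∸ 1)
  path (suc m) _ =
    PbIs×DiamIs-intro (PathG (suc m)) m (fromℕ m) path-DistLe (path-far m) path-cost≤
  cycle : (n : ℕ) → 3 ≤ n → PbIs (CycleG n) (n / 2) × DiamIs (CycleG n) (n / 2)
  cycle (suc m) _ =
    PbIs×DiamIs-intro (CycleG (suc m)) diam antipode cycle-DistLe cycle-far cycle-cost≤
    where open Cycle m
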